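{- For every $d \geq 3$ there exists a board size $n > 3$ such that no placement of $n$ queens in the $d$-dimensional chess space of size $n$ attacks all board positions.
   Context: A $d$-dimensional chess space of size $n$ is the set of positions $\{0,1,\ldots,n-1\}^d$. A queen at position $q$ attacks a position $x$ of the board if $x = q + s\delta$ for some integer $s$ and some $\delta \in \{ -1,0,1\}^d$ other than the zero vector (in particular a queen attacks the position it occupies). A placement of queens attacks all board positions if every position is attacked by at least one queen. -}

module Defs where

open import Data.Nat using (ℕ)
open import Data.Integer using (ℤ; +_; _+_; _*_; 0ℤ; 1ℤ; -1ℤ)
open import Data.Fin using (Fin; toℕ)
open import Data.Vec using (Vec; lookup)
open import Data.Product using (∃; _×_; Σ)
open import Relation.Binary.PropositionalEquality using (_≡_)
open import Relation.Nullary using (¬_)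

Position : ℕ → ℕ → Set
Position d n = Vec (Fin n) d

data Step : Set where
  minus zero plus : Step

stepℤ : Step → ℤ
stepℤ minus = -1ℤ
stepℤ zero  = 0ℤ
stepℤ plus  = 1ℤ

Direction : ℕ → Set
Direction d = Vec Step d

NonZeroDir : ∀ {d} → Direction d → Set
NonZeroDir {d} δ = ¬ (∀ (i : Fin d) → lookup δ i ≡ zero)

coord : ∀ {d n} → Position d n → Fin d → ℤ
coord p i = + toℕ (lookup p i)

Attacks : ∀ {d n} → Position d n → Position d n → Set
Attacks {d} {n} q x =
  Σ (Direction d) λ δ → NonZeroDir δ ×
    ∃ λ (s : ℤ) → ∀ (i : Fin d) → coord x i ≡ coord q i + s * stepℤ (lookup δ i)

AttacksAll : ∀ {d n k} → Vec (Position d n) k → Set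
AttacksAll {d} {n} {k} Q =
  ∀ (x : Position d n) → ∃ λ (j : Fin k) → Attacks (lookup Q j) x

-- A queen q attacks x along a nonzero direction δ, and if δᵢ ≠ 0 the
-- coordinate xᵢ fixes the multiple s of δ and hence x. So every position is
-- determined by its attacking queen j, the direction δ and one coordinate:
-- n ^ d ≤ k · 3 ^ d · n for k queens. With k = n = 3 ^ d + 1 and d ≥ 3 this
-- fails, since n ^ d ≥ n ^ 3 > n · 3 ^ d · n.
module Submission where

open import Defs
open import Data.Nat using (ℕ; _≥_; _>_)
open import Data.Vec using (Vec)
open import Data.Product using (∃; _×_)
open import Relation.Nullary using (¬_)

open import Data.Nat using (suc; s≤s; z≤n; _*_; _^_; _≤_; _<_)
open import Data.Nat.Properties
  using (*-identityʳ; *-monoˡ-<; *-monoʳ-<; ^-monoʳ-≤; <-≤-trans; <⇒≱; ≤-refl; module ≤-Reasoning)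
open import Data.Integer as ℤ using (ℤ; +_; -1ℤ; 1ℤ)
open import Data.Integer.Properties as ℤ using (*-cancelʳ-≡)
open import Algebra.Properties.AbelianGroup ℤ.+-0-abelianGroup using (∙-cancelˡ)
open import Data.Fin using (Fin; toℕ; combine; funToFin; finToFun)
  renaming (zero to fzero; suc to fsuc)
open import Data.Fin.Properties
  using (toℕ-injective; combine-injective; any?; injective⇒≤; funToFin-finToFin; finToFun-funToFin)
open import Data.Vec using (lookup; tabulate)
open import Data.Vec.Properties using (tabulate∘lookup; tabulate-cong; lookup∘tabulate)
open import Data.Product using (_,_; proj₁)
open import Data.Empty using (⊥-elim-irr)
open import Function using (_∘_)
open import Function.Definitions using (Injective)
open import Relation.Nullary using (Dec; yes; no; ¬?; contradiction; decidable-stable)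
open import Relation.Binary.PropositionalEquality

≗-lookup⇒≡ : ∀ {a} {A : Set a} {m} (xs ys : Vec A m) → lookup xs ≗ lookup ys → xs ≡ ys
≗-lookup⇒≡ xs ys xs≗ys = begin
  xs                   ≡⟨ tabulate∘lookup xs ⟨
  tabulate (lookup xs) ≡⟨ tabulate-cong xs≗ys ⟩
  tabulate (lookup ys) ≡⟨ tabulate∘lookup ys ⟩
  ys                   ∎
  where open ≡-Reasoning

funToFin-cong : ∀ {m n} {f g : Fin m → Fin n} → f ≗ g → funToFin f ≡ funToFin g
funToFin-cong {ℕ.zero}  f≗g = refl
funToFin-cong {suc m}   f≗g = cong₂ combine (f≗g fzero) (funToFin-cong (f≗g ∘ fsuc))

funToFin-injective : ∀ {m n} {f g : Fin m → Fin n} → funToFin f ≡ funToFin g → f ≗ g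
funToFin-injective {f = f} {g} eq i = begin
  f i                       ≡⟨ finToFun-funToFin f i ⟨
  finToFun (funToFin f) i   ≡⟨ cong (λ c → finToFun c i) eq ⟩
  finToFun (funToFin g) i   ≡⟨ finToFun-funToFin g i ⟩
  g i                       ∎
  where open ≡-Reasoning

tabulate∘finToFun-injective : ∀ {m d} → Injective _≡_ _≡_ (tabulate ∘ finToFun {m} {d})
tabulate∘finToFun-injective {m} {d} {c} {c′} eq = begin
  c                               ≡⟨ funToFin-finToFin {d} {m} c ⟨
  funToFin {d} {m} (finToFun c)   ≡⟨ funToFin-cong same-values ⟩
  funToFin {d} {m} (finToFun c′)  ≡⟨ funToFin-finToFin {d} {m} c′ ⟩
  c′                              ∎
  where
  open ≡-Reasoning
  same-values : finToFun c ≗ finToFun c′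
  same-values i = begin
    finToFun c i                         ≡⟨ lookup∘tabulate (finToFun c) i ⟨
    lookup (tabulate (finToFun c)) i     ≡⟨ cong (λ v → lookup v i) eq ⟩
    lookup (tabulate (finToFun c′)) i    ≡⟨ lookup∘tabulate (finToFun c′) i ⟩
    finToFun c′ i                        ∎

stepToFin : Step → Fin 3
stepToFin minus = fzero
stepToFin zero  = fsuc fzero
stepToFin plus  = fsuc (fsuc fzero)

stepFromFin : Fin 3 → Step
stepFromFin fzero               = minus
stepFromFin (fsuc fzero)        = zero
stepFromFin (fsuc (fsuc fzero)) = plus

stepFromFin∘stepToFin : ∀ σ → stepFromFin (stepToFin σ) ≡ σ
stepFromFin∘stepToFin minus = refl
stepFromFin∘stepToFin zero  = refl
stepFromFin∘stepToFin plus  = refl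

directionToFin : ∀ {d} → Direction d → Fin (3 ^ d)
directionToFin δ = funToFin (stepToFin ∘ lookup δ)

directionToFin-injective : ∀ {d} → Injective _≡_ _≡_ (directionToFin {d})
directionToFin-injective {d} {δ} {δ′} eq = ≗-lookup⇒≡ δ δ′ λ i → begin
  lookup δ i                            ≡⟨ stepFromFin∘stepToFin (lookup δ i) ⟨
  stepFromFin (stepToFin (lookup δ i))  ≡⟨ cong stepFromFin (funToFin-injective eq i) ⟩
  stepFromFin (stepToFin (lookup δ′ i)) ≡⟨ stepFromFin∘stepToFin (lookup δ′ i) ⟩
  lookup δ′ i                           ∎
  where open ≡-Reasoning

isZero? : (σ : Step) → Dec (σ ≡ zero)
isZero? minus = no λ ()
isZero? zero  = yes refl
isZero? plus  = no λ ()

-- The proof of nonzeroness is irrelevant, so the chosen coordinate depends on δ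
-- alone; attackCode-injective relies on this.
nonzeroCoordinate : ∀ {d} (δ : Direction d) → .(NonZeroDir δ) → ∃ λ i → lookup δ i ≢ zero
nonzeroCoordinate δ δ≢0 with any? (λ i → ¬? (isZero? (lookup δ i)))
... | yes found = found
... | no none   =
  ⊥-elim-irr (δ≢0 λ i → decidable-stable (isZero? (lookup δ i)) (λ δᵢ≢0 → none (i , δᵢ≢0)))

stepℤ-cancelʳ : ∀ {σ} → σ ≢ zero → ∀ s t → s ℤ.* stepℤ σ ≡ t ℤ.* stepℤ σ → s ≡ t
stepℤ-cancelʳ {minus} _   s t = *-cancelʳ-≡ s t -1ℤ
stepℤ-cancelʳ {zero}  σ≢0 _ _ = contradiction refl σ≢0
stepℤ-cancelʳ {plus}  _   s t = *-cancelʳ-≡ s t 1ℤ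

OnLine : ∀ {d n} → Position d n → Direction d → ℤ → Position d n → Set
OnLine q δ s x = ∀ i → coord x i ≡ coord q i ℤ.+ s ℤ.* stepℤ (lookup δ i)

onLine-injective : ∀ {d n} {q x y : Position d n} {δ s t} i → lookup δ i ≢ zero →
                   OnLine q δ s x → OnLine q δ t y → lookup x i ≡ lookup y i → x ≡ y
onLine-injective {q = q} {x} {y} {δ} {s} {t} i δᵢ≢0 x∈ℓ y∈ℓ xᵢ≡yᵢ =
  ≗-lookup⇒≡ x y λ j → toℕ-injective (ℤ.+-injective (begin
    coord x j                                 ≡⟨ x∈ℓ j ⟩
    coord q j ℤ.+ s ℤ.* stepℤ (lookup δ j)    ≡⟨ cong (λ r → coord q j ℤ.+ r ℤ.* stepℤ (lookup δ j)) s≡t ⟩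
    coord q j ℤ.+ t ℤ.* stepℤ (lookup δ j)    ≡⟨ y∈ℓ j ⟨
    coord y j                                 ∎))
  where
  open ≡-Reasoning
  s≡t : s ≡ t
  s≡t = stepℤ-cancelʳ δᵢ≢0 s t (∙-cancelˡ (coord q i) _ _ (begin
    coord q i ℤ.+ s ℤ.* stepℤ (lookup δ i)    ≡⟨ x∈ℓ i ⟨
    coord x i                                 ≡⟨ cong (+_ ∘ toℕ) xᵢ≡yᵢ ⟩
    coord y i                                 ≡⟨ y∈ℓ i ⟩
    coord q i ℤ.+ t ℤ.* stepℤ (lookup δ i)    ∎))

attackCode : ∀ {d n} (q x : Position d n) → Attacks q x → Fin (3 ^ d * n)
attackCode q x (δ , δ≢0 , _) =
  combine (directionToFin δ) (lookup x (proj₁ (nonzeroCoordinate δ δ≢0)))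

attackCode-injective : ∀ {d n} (q x y : Position d n) (a : Attacks q x) (b : Attacks q y) →
                       attackCode q x a ≡ attackCode q y b → x ≡ y
attackCode-injective q x y (δ , δ≢0 , s , x∈ℓ) (δ′ , _ , t , y∈ℓ) eq with combine-injective _ _ _ _ eq
... | codes , xᵢ≡yᵢ with directionToFin-injective {x = δ} {δ′} codes
... | refl = let i , δᵢ≢0 = nonzeroCoordinate δ δ≢0 in
             onLine-injective {q = q} {δ = δ} {s} {t} i δᵢ≢0 x∈ℓ y∈ℓ xᵢ≡yᵢ

AttackedBy : ∀ {d n k} → Vec (Position d n) k → Position d n → Set
AttackedBy Q x = ∃ λ j → Attacks (lookup Q j) x

attackerCode : ∀ {d n k} (Q : Vec (Position d n) k) x → AttackedBy Q x → Fin (k * (3 ^ d * n))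
attackerCode Q x (j , a) = combine j (attackCode (lookup Q j) x a)

attackerCode-injective : ∀ {d n k} (Q : Vec (Position d n) k) x y
                         (u : AttackedBy Q x) (v : AttackedBy Q y) →
                         attackerCode Q x u ≡ attackerCode Q y v → x ≡ y
attackerCode-injective Q x y (j , a) (j′ , b) eq with combine-injective j _ j′ _ eq
... | refl , codes = attackCode-injective (lookup Q j) x y a b codes

attacksAll⇒≤ : ∀ {d n k} (Q : Vec (Position d n) k) → AttacksAll Q → n ^ d ≤ k * (3 ^ d * n)
attacksAll⇒≤ {d} {n} {k} Q attacked =
  injective⇒≤ {f = code ∘ tabulate ∘ finToFun {n} {d}} (tabulate∘finToFun-injective ∘ code-injective)
  where
  code : Position d n → Fin (k * (3 ^ d * n))
  code x = attackerCode Q x (attacked x)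
  code-injective : Injective _≡_ _≡_ code
  code-injective {x} {y} = attackerCode-injective Q x y (attacked x) (attacked y)

n*[a*n]<n^3 : ∀ {a n} → a < n → n * (a * n) < n ^ 3
n*[a*n]<n^3 {a} {n@(suc _)} a<n = begin-strict
  n * (a * n)        <⟨ *-monoʳ-< n (*-monoˡ-< n a<n) ⟩
  n * (n * n)        ≡⟨ cong (λ m → n * (n * m)) (*-identityʳ n) ⟨
  n ^ 3              ∎
  where open ≤-Reasoning

corollary1 : ∀ (d : ℕ) → d ≥ 3 →
    ∃ λ (n : ℕ) → n > 3 ×
      ((Q : Vec (Position d n) n) → ¬ AttacksAll Q)
corollary1 d d≥3 = n , s≤s 3≤3^d , λ Q attacked → <⇒≱ too-many-positions (attacksAll⇒≤ Q attacked)
  where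
  n = suc (3 ^ d)
  3≤3^d : 3 ≤ 3 ^ d
  3≤3^d = ^-monoʳ-≤ 3 (<-≤-trans (s≤s z≤n) d≥3)
  too-many-positions : n * (3 ^ d * n) < n ^ d
  too-many-positions = <-≤-trans (n*[a*n]<n^3 {3 ^ d} ≤-refl) (^-monoʳ-≤ n d≥3)
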